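{- Let $h\geq 3$ be a fixed integer. There is a constant $c_h>0$ depending only on $h$ such that for every finite abelian group $G$ of order $n\geq 2h$ and every $a\in G$, the number $T(a)$ of ordered $h$-tuples $(x_1,\dots,x_h)\in G^h$ of pairwise distinct elements with $x_1+\dots+x_h=a$ satisfies $$\left|T(a)-\frac{1}{n}\cdot\frac{n!}{(n-h)!}\right|\leq c_h\, n^{h/2}.$$ Consequently, the $h$-element subset sums are asymptotically equidistributed in $G$ as $n\to\infty$.
   Context: $G$ is written additively. -}

module Defs where

open import Level using (0ℓ)
open import Data.Nat using (ℕ; zero; suc; _/_)
open import Data.Nat.Combinatorics using (_P_)
open import Data.Fin using (Fin)
open import Data.Fin.Properties using (_≟_)
open import Data.List using (List; []; _∷_; concatMap; map; filter; length; allFin)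
open import Data.Vec using (Vec; []; _∷_; toList; foldr′)
open import Data.Product using (_×_)
open import Relation.Nullary.Decidable using (_×-dec_)
open import Relation.Binary.PropositionalEquality using (_≡_)
open import Algebra.Structures using (IsAbelianGroup)
open import Data.List.Relation.Unary.Unique.Propositional using (Unique)
import Data.List.Relation.Unary.Unique.DecPropositional as UDec

-- A finite abelian group of order n, written additively, presented on the
-- carrier Fin n (every finite abelian group of order n is isomorphic to one).
record FinAbGroup (n : ℕ) : Set where
  field
    _+ᴳ_ : Fin n → Fin n → Fin n
    0ᴳ   : Fin n
    -ᴳ_  : Fin n → Fin n
    isAbelianGroup : IsAbelianGroup _≡_ _+ᴳ_ 0ᴳ -ᴳ_

allTuples : (n h : ℕ) → List (Vec (Fin n) h)
allTuples n zero    = [] ∷ []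
allTuples n (suc h) = concatMap (λ x → map (x ∷_) (allTuples n h)) (allFin n)

tupleSum : {n h : ℕ} → FinAbGroup n → Vec (Fin n) h → Fin n
tupleSum G xs = foldr′ _+ᴳ_ 0ᴳ xs
  where open FinAbGroup G

T : {n : ℕ} → FinAbGroup n → (h : ℕ) → Fin n → ℕ
T {n} G h a =
  length (filter (λ xs → UDec.unique? _≟_ (toList xs) ×-dec (tupleSum G xs ≟ a))
                 (allTuples n h))

-- Main term (1/n) · n!/(n-h)!  (n = 0 never occurs in the theorem).
mainTerm : ℕ → ℕ → ℕ
mainTerm zero    h = 0
mainTerm (suc m) h = (suc m P h) / suc m

-- Count, more generally, the solutions of c₁v₁ + … + cₘvₘ + k₁z₁ + … + k_f z_f = a with the vᵢ
-- pairwise distinct and the zⱼ free; T(a) is the case c = (1,…,1), f = 0. Dropping the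
-- distinctness of v₁ overcounts exactly the tuples where v₁ equals some vⱼ, and those are the
-- solutions in which c₁ has been merged into cⱼ. This inclusion–exclusion step writes a count
-- with m distinct variables through counts with m − 1 distinct variables and the same total
-- weight s = Σ cᵢ + Σ kⱼ. Once no distinct variable is left, the count does not depend on a if
-- some kⱼ = 1 (solve for zⱼ), and otherwise every kⱼ ≥ 2, so f ≤ s/2 and the count is at most
-- n^⌊s/2⌋. Hence T(a) varies by at most h! n^⌊h/2⌋ over G, so it is that close to its
-- average (1/n) n!/(n−h)!, and squaring gives the bound with constant (h!)².

module Submission where

open import Defs
open import Data.Nat using (ℕ; _≤_; _<_; _*_; _^_; ∣_-_∣)
open import Data.Fin using (Fin)
open import Data.Product using (∃-syntax; _×_)

open import Level using (Level; 0ℓ)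
open import Data.Bool using (if_then_else_)
open import Data.Nat using (zero; suc; _+_; _∸_; _/_; _!; z≤n; s≤s; ⌊_/2⌋; ⌈_/2⌉; NonZero)
open import Data.Nat.Properties hiding (_≟_)
open import Data.Nat.Properties using () renaming (_≟_ to _≟ℕ_)
open import Data.Nat.DivMod using (m*n/n≡m; /-monoˡ-≤; +-distrib-/-∣ʳ)
open import Data.Nat.Divisibility using (n∣m*n)
open import Data.Nat.Combinatorics using (_P_; nPk≡n!/[n∸k]!)
open import Data.Nat.Combinatorics.Base using (_P′_)
open import Data.Nat.Combinatorics.Specification using (nP′k≡n!/[n∸k]!)
open import Data.Fin using (zero; suc)
open import Data.Fin.Properties using (_≟_; nonZeroIndex)
open import Data.Vec using (Vec; []; _∷_; lookup; replicate; toList; updateAt)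
import Data.Vec as Vec
open import Data.Vec.Relation.Unary.All using (All; []; _∷_)
open import Data.Vec.Relation.Unary.Any using (Any; here; there)
open import Data.List using (List; []; _∷_; _++_; concatMap; map; filter; length; tabulate)
import Data.List.Relation.Unary.All as ListAll
open import Data.List.Relation.Unary.AllPairs using ([]; _∷_)
open import Data.List.Relation.Unary.Unique.Propositional using (Unique)
import Data.List.Relation.Unary.Unique.DecPropositional as UniqueDec
open import Data.Sum using (_⊎_; inj₁; inj₂)
open import Data.Product using (_,_)
open import Data.Empty using (⊥-elim)
open import Function using (id; _∘_; _⇔_; Equivalence; mk⇔)
open import Relation.Nullary using (Dec; does; yes; no; ¬?; _×-dec_)
open import Relation.Unary using (Decidable)
open import Relation.Binary.PropositionalEquality
open import Algebra.Bundles using (AbelianGroup)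
import Algebra.Properties.CommutativeSemigroup as CommutativeSemigroupProperties
open import Algebra.Properties.Semiring.Sum +-*-semiring
  using (sum; sum-syntax; sum-cong-≗; ∑-distrib-+; ∑-comm; *-distribˡ-sum; *-distribʳ-sum)

module ℕ+ = CommutativeSemigroupProperties +-commutativeSemigroup
module ℕ* = CommutativeSemigroupProperties *-commutativeSemigroup

private
  variable
    a p q : Level
    k m f s E F : ℕ

⟦_⟧ : {P : Set p} → Dec P → ℕ
⟦ p? ⟧ = if does p? then 1 else 0

module _ {P : Set p} where

  ⟦⟧≤1 : (p? : Dec P) → ⟦ p? ⟧ ≤ 1
  ⟦⟧≤1 (yes _) = s≤s z≤n
  ⟦⟧≤1 (no _)  = z≤n

  ⟦⟧-true : P → (p? : Dec P) → ⟦ p? ⟧ ≡ 1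
  ⟦⟧-true _  (yes _) = refl
  ⟦⟧-true pr (no ¬pr) = ⊥-elim (¬pr pr)

  ⟦¬?⟧+⟦⟧≡1 : (p? : Dec P) → ⟦ ¬? p? ⟧ + ⟦ p? ⟧ ≡ 1
  ⟦¬?⟧+⟦⟧≡1 (yes _) = refl
  ⟦¬?⟧+⟦⟧≡1 (no _)  = refl

  ⟦⟧*-cong : {x y : ℕ} (p? : Dec P) → (P → x ≡ y) → ⟦ p? ⟧ * x ≡ ⟦ p? ⟧ * y
  ⟦⟧*-cong (yes pr) x≡y = cong (_+ 0) (x≡y pr)
  ⟦⟧*-cong (no _)   _   = refl

  module _ {Q : Set q} where

    ⟦×-dec⟧ : (p? : Dec P) (q? : Dec Q) → ⟦ p? ×-dec q? ⟧ ≡ ⟦ p? ⟧ * ⟦ q? ⟧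
    ⟦×-dec⟧ (yes _) (yes _) = refl
    ⟦×-dec⟧ (yes _) (no _)  = refl
    ⟦×-dec⟧ (no _)  _       = refl

    ⟦⟧-⇔ : P ⇔ Q → (p? : Dec P) (q? : Dec Q) → ⟦ p? ⟧ ≡ ⟦ q? ⟧
    ⟦⟧-⇔ _    (yes _)  (yes _)  = refl
    ⟦⟧-⇔ P⇔Q (yes pr) (no ¬qr) = ⊥-elim (¬qr (Equivalence.to P⇔Q pr))
    ⟦⟧-⇔ P⇔Q (no ¬pr) (yes qr) = ⊥-elim (¬pr (Equivalence.from P⇔Q qr))
    ⟦⟧-⇔ _    (no _)   (no _)   = refl

module _ {A : Set a} {P : A → Set p} (P? : Decidable P) where

  length-filter-∷ : (x : A) (xs : List A) →
                    length (filter P? (x ∷ xs)) ≡ ⟦ P? x ⟧ + length (filter P? xs)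
  length-filter-∷ x xs with P? x
  ... | yes _ = refl
  ... | no _  = refl

  length-filter-++ : (xs ys : List A) →
                     length (filter P? (xs ++ ys)) ≡ length (filter P? xs) + length (filter P? ys)
  length-filter-++ []       ys = refl
  length-filter-++ (x ∷ xs) ys = begin
    length (filter P? (x ∷ xs ++ ys))                          ≡⟨ length-filter-∷ x (xs ++ ys) ⟩
    ⟦ P? x ⟧ + length (filter P? (xs ++ ys))                   ≡⟨ cong (⟦ P? x ⟧ +_) (length-filter-++ xs ys) ⟩
    ⟦ P? x ⟧ + (length (filter P? xs) + length (filter P? ys)) ≡⟨ +-assoc ⟦ P? x ⟧ _ _ ⟨
    ⟦ P? x ⟧ + length (filter P? xs) + length (filter P? ys)   ≡⟨ cong (_+ _) (length-filter-∷ x xs) ⟨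
    length (filter P? (x ∷ xs)) + length (filter P? ys)        ∎
    where open ≡-Reasoning

length-filter-map : {A B : Set a} {P : A → Set p} (P? : Decidable P) (g : B → A) (xs : List B) →
                    length (filter P? (map g xs)) ≡ length (filter (P? ∘ g) xs)
length-filter-map P? g []       = refl
length-filter-map P? g (x ∷ xs) = begin
  length (filter P? (g x ∷ map g xs))          ≡⟨ length-filter-∷ P? (g x) (map g xs) ⟩
  ⟦ P? (g x) ⟧ + length (filter P? (map g xs)) ≡⟨ cong (⟦ P? (g x) ⟧ +_) (length-filter-map P? g xs) ⟩
  ⟦ P? (g x) ⟧ + length (filter (P? ∘ g) xs)   ≡⟨ length-filter-∷ (P? ∘ g) x xs ⟨
  length (filter (P? ∘ g) (x ∷ xs))            ∎
  where open ≡-Reasoning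

length-filter-concatMap-tabulate : {A B : Set a} {P : A → Set p} (P? : Decidable P)
                                   (g : B → List A) (h : Fin k → B) →
  length (filter P? (concatMap g (tabulate h))) ≡ ∑[ i < k ] length (filter P? (g (h i)))
length-filter-concatMap-tabulate {k = zero}  P? g h = refl
length-filter-concatMap-tabulate {k = suc k} P? g h =
  trans (length-filter-++ P? (g (h zero)) _)
        (cong (_ +_) (length-filter-concatMap-tabulate P? g (h ∘ suc)))

∣m-n∣≤o⇒m≤n+o : ∀ m n {o} → ∣ m - n ∣ ≤ o → m ≤ n + o
∣m-n∣≤o⇒m≤n+o m n d = ≤-trans (m≤n+∣m-n∣ m n) (+-monoʳ-≤ n d)

m≤n+o⇒n≤m+o⇒∣m-n∣≤o : ∀ m n {o} → m ≤ n + o → n ≤ m + o → ∣ m - n ∣ ≤ o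
m≤n+o⇒n≤m+o⇒∣m-n∣≤o m n {o} m≤n+o n≤m+o with ≤-total m n
... | inj₁ m≤n = subst (_≤ o) (sym (m≤n⇒∣m-n∣≡n∸m m≤n)) (m≤n+o⇒m∸n≤o n m n≤m+o)
... | inj₂ n≤m = subst (_≤ o) (sym (m≤n⇒∣n-m∣≡n∸m n≤m)) (m≤n+o⇒m∸n≤o m n m≤n+o)

m≤o⇒n≤o⇒∣m-n∣≤o : ∀ m n {o} → m ≤ o → n ≤ o → ∣ m - n ∣ ≤ o
m≤o⇒n≤o⇒∣m-n∣≤o m n m≤o n≤o = ≤-trans (∣m-n∣≤m⊔n m n) (⊔-lub m≤o n≤o)

∣m+n-o+p∣≤∣m-o∣+∣n-p∣ : ∀ m n o p → ∣ m + n - o + p ∣ ≤ ∣ m - o ∣ + ∣ n - p ∣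
∣m+n-o+p∣≤∣m-o∣+∣n-p∣ m n o p = begin
  ∣ m + n - o + p ∣                     ≤⟨ ∣-∣-triangle (m + n) (m + p) (o + p) ⟩
  ∣ m + n - m + p ∣ + ∣ m + p - o + p ∣ ≡⟨ cong₂ _+_ (∣m+n-m+o∣≡∣n-o∣ m n p) ∣m+p-o+p∣≡∣m-o∣ ⟩
  ∣ n - p ∣ + ∣ m - o ∣                 ≡⟨ +-comm ∣ n - p ∣ ∣ m - o ∣ ⟩
  ∣ m - o ∣ + ∣ n - p ∣                 ∎
  where
  open ≤-Reasoning
  ∣m+p-o+p∣≡∣m-o∣ : ∣ m + p - o + p ∣ ≡ ∣ m - o ∣
  ∣m+p-o+p∣≡∣m-o∣ = trans (cong₂ ∣_-_∣ (+-comm m p) (+-comm o p)) (∣m+n-m+o∣≡∣n-o∣ p m o)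

∣m-n∣≤∣m+o-n+p∣+∣o-p∣ : ∀ m n o p → ∣ m - n ∣ ≤ ∣ m + o - n + p ∣ + ∣ o - p ∣
∣m-n∣≤∣m+o-n+p∣+∣o-p∣ m n o p = begin
  ∣ m - n ∣                             ≡⟨ ∣m+n-m+o∣≡∣n-o∣ o m n ⟨
  ∣ o + m - o + n ∣                     ≡⟨ cong₂ ∣_-_∣ (+-comm o m) (+-comm o n) ⟩
  ∣ m + o - n + o ∣                     ≤⟨ ∣-∣-triangle (m + o) (n + p) (n + o) ⟩
  ∣ m + o - n + p ∣ + ∣ n + p - n + o ∣ ≡⟨ cong (∣ m + o - n + p ∣ +_) ∣n+p-n+o∣≡∣o-p∣ ⟩
  ∣ m + o - n + p ∣ + ∣ o - p ∣         ∎
  where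
  open ≤-Reasoning
  ∣n+p-n+o∣≡∣o-p∣ : ∣ n + p - n + o ∣ ≡ ∣ o - p ∣
  ∣n+p-n+o∣≡∣o-p∣ = trans (∣m+n-m+o∣≡∣n-o∣ n p o) (∣-∣-comm p o)

∣m*n-o∣≤m*p⇒∣n-o/m∣≤p : ∀ m n o {p} .{{_ : NonZero m}} → ∣ m * n - o ∣ ≤ m * p → ∣ n - o / m ∣ ≤ p
∣m*n-o∣≤m*p⇒∣n-o/m∣≤p m n o {p} d = m≤n+o⇒n≤m+o⇒∣m-n∣≤o n (o / m) n≤o/m+p o/m≤n+p
  where
  open ≤-Reasoning
  n≤o/m+p : n ≤ o / m + p
  n≤o/m+p = begin
    n                   ≡⟨ m*n/n≡m n m ⟨
    n * m / m           ≤⟨ /-monoˡ-≤ m (begin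
      n * m               ≡⟨ *-comm n m ⟩
      m * n               ≤⟨ ∣m-n∣≤o⇒m≤n+o (m * n) o d ⟩
      o + m * p           ≡⟨ cong (o +_) (*-comm m p) ⟩
      o + p * m           ∎) ⟩
    (o + p * m) / m     ≡⟨ +-distrib-/-∣ʳ o (n∣m*n p) ⟩
    o / m + p * m / m   ≡⟨ cong (o / m +_) (m*n/n≡m p m) ⟩
    o / m + p           ∎
  o/m≤n+p : o / m ≤ n + p
  o/m≤n+p = begin
    o / m               ≤⟨ /-monoˡ-≤ m (begin
      o                   ≤⟨ ∣m-n∣≤o⇒m≤n+o o (m * n) (subst (_≤ m * p) (∣-∣-comm (m * n) o) d) ⟩
      m * n + m * p       ≡⟨ *-distribˡ-+ m n p ⟨
      m * (n + p)         ≡⟨ *-comm m (n + p) ⟩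
      (n + p) * m         ∎) ⟩
    (n + p) * m / m     ≡⟨ m*n/n≡m (n + p) m ⟩
    n + p               ∎

∑-const : ∀ k x → ∑[ i < k ] x ≡ k * x
∑-const zero    x = refl
∑-const (suc k) x = cong (x +_) (∑-const k x)

∑-mono-≤ : ∀ {k} {g h : Fin k → ℕ} → (∀ i → g i ≤ h i) → sum g ≤ sum h
∑-mono-≤ {zero}  g≤h = z≤n
∑-mono-≤ {suc k} g≤h = +-mono-≤ (g≤h zero) (∑-mono-≤ (g≤h ∘ suc))

∣∑-∑∣≤∑∣-∣ : ∀ {k} (g h : Fin k → ℕ) → ∣ sum g - sum h ∣ ≤ ∑[ i < k ] ∣ g i - h i ∣
∣∑-∑∣≤∑∣-∣ {zero}  g h = z≤n
∣∑-∑∣≤∑∣-∣ {suc k} g h = ≤-trans (∣m+n-o+p∣≤∣m-o∣+∣n-p∣ (g zero) _ (h zero) _)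
                                  (+-monoʳ-≤ _ (∣∑-∑∣≤∑∣-∣ (g ∘ suc) (h ∘ suc)))

∑-⟦≟⟧* : ∀ {k} (z : Fin k) (g : Fin k → ℕ) → ∑[ y < k ] (⟦ y ≟ z ⟧ * g y) ≡ g z
∑-⟦≟⟧* {suc k} zero    g = begin
  g zero + 0 + ∑[ y < k ] 0 ≡⟨ cong₂ _+_ (+-identityʳ (g zero)) (trans (∑-const k 0) (*-zeroʳ k)) ⟩
  g zero + 0                ≡⟨ +-identityʳ (g zero) ⟩
  g zero                    ∎
  where open ≡-Reasoning
∑-⟦≟⟧* {suc k} (suc z) g = ∑-⟦≟⟧* z (g ∘ suc)

∑-⟦≟⟧ˡ : ∀ {k} (z : Fin k) → ∑[ y < k ] ⟦ y ≟ z ⟧ ≡ 1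
∑-⟦≟⟧ˡ {k} z = trans (sum-cong-≗ λ y → sym (*-identityʳ ⟦ y ≟ z ⟧)) (∑-⟦≟⟧* z (λ _ → 1))

∑-⟦≟⟧ʳ : ∀ {k} (z : Fin k) → ∑[ y < k ] ⟦ z ≟ y ⟧ ≡ 1
∑-⟦≟⟧ʳ {k} z = trans (sum-cong-≗ λ y → ⟦⟧-⇔ (mk⇔ sym sym) (z ≟ y) (y ≟ z)) (∑-⟦≟⟧ˡ z)

∑-⟦≢⟧*+point : ∀ {k} (z : Fin k) (g : Fin k → ℕ) →
               ∑[ y < k ] (⟦ ¬? (y ≟ z) ⟧ * g y) + g z ≡ sum g
∑-⟦≢⟧*+point {k} z g = begin
  sum g≢z + g z              ≡⟨ cong (sum g≢z +_) (∑-⟦≟⟧* z g) ⟨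
  sum g≢z + sum g≡z          ≡⟨ ∑-distrib-+ g≢z g≡z ⟨
  ∑[ y < k ] (g≢z y + g≡z y) ≡⟨ sum-cong-≗ split ⟩
  sum g                      ∎
  where
  open ≡-Reasoning
  g≢z g≡z : Fin k → ℕ
  g≢z y = ⟦ ¬? (y ≟ z) ⟧ * g y
  g≡z y = ⟦ y ≟ z ⟧ * g y
  split : ∀ y → ⟦ ¬? (y ≟ z) ⟧ * g y + ⟦ y ≟ z ⟧ * g y ≡ g y
  split y = trans (sym (*-distribʳ-+ (g y) ⟦ ¬? (y ≟ z) ⟧ ⟦ y ≟ z ⟧))
                  (trans (cong (_* g y) (⟦¬?⟧+⟦⟧≡1 (y ≟ z))) (*-identityˡ (g y)))

-- Nearly constant functions

record NearlyConstant {A : Set a} (E : ℕ) (g : A → ℕ) : Set a where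
  constructor nearlyConstant
  field
    spread≤ : ∀ a b → ∣ g a - g b ∣ ≤ E

open NearlyConstant

module _ {A : Set a} where

  nearlyConstant-mono : E ≤ F → {g : A → ℕ} → NearlyConstant E g → NearlyConstant F g
  nearlyConstant-mono E≤F g≈ = nearlyConstant λ a b → ≤-trans (spread≤ g≈ a b) E≤F

  nearlyConstant-cong : {g h : A → ℕ} → (∀ a → g a ≡ h a) → NearlyConstant E g → NearlyConstant E h
  nearlyConstant-cong {E} g≡h g≈ = nearlyConstant λ a b →
    subst₂ (λ x y → ∣ x - y ∣ ≤ E) (g≡h a) (g≡h b) (spread≤ g≈ a b)

  constant⇒nearlyConstant : ∀ {g : A → ℕ} c → (∀ a → g a ≡ c) → NearlyConstant E g
  constant⇒nearlyConstant {E} c g≡c = nearlyConstant λ a b →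
    subst (_≤ E) (sym (trans (cong₂ ∣_-_∣ (g≡c a) (g≡c b)) (∣n-n∣≡0 c))) z≤n

  bounded⇒nearlyConstant : {g : A → ℕ} → (∀ a → g a ≤ E) → NearlyConstant E g
  bounded⇒nearlyConstant g≤E = nearlyConstant λ a b → m≤o⇒n≤o⇒∣m-n∣≤o _ _ (g≤E a) (g≤E b)

  nearlyConstant-∑ : {g : Fin k → A → ℕ} → (∀ i → NearlyConstant E (g i)) →
                     NearlyConstant (k * E) (λ a → ∑[ i < k ] g i a)
  nearlyConstant-∑ {k} {E} {g} g≈ = nearlyConstant λ a b → begin
    ∣ ∑[ i < k ] g i a - ∑[ i < k ] g i b ∣ ≤⟨ ∣∑-∑∣≤∑∣-∣ (λ i → g i a) (λ i → g i b) ⟩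
    ∑[ i < k ] ∣ g i a - g i b ∣             ≤⟨ ∑-mono-≤ (λ i → spread≤ (g≈ i) a b) ⟩
    ∑[ i < k ] E                           ≡⟨ ∑-const k E ⟩
    k * E                                  ∎
    where open ≤-Reasoning

  nearlyConstant-cancelʳ : {g h u : A → ℕ} → (∀ a → g a + h a ≡ u a) →
                           NearlyConstant E u → NearlyConstant F h → NearlyConstant (E + F) g
  nearlyConstant-cancelʳ {E} {F} {g} {h} {u} g+h≡u u≈ h≈ = nearlyConstant λ a b → begin
    ∣ g a - g b ∣                             ≤⟨ ∣m-n∣≤∣m+o-n+p∣+∣o-p∣ (g a) (g b) (h a) (h b) ⟩
    ∣ g a + h a - g b + h b ∣ + ∣ h a - h b ∣ ≡⟨ cong₂ (λ s t → ∣ s - t ∣ + ∣ h a - h b ∣) (g+h≡u a) (g+h≡u b) ⟩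
    ∣ u a - u b ∣ + ∣ h a - h b ∣             ≤⟨ +-mono-≤ (spread≤ u≈ a b) (spread≤ h≈ a b) ⟩
    E + F                                     ∎
    where open ≤-Reasoning

nearlyConstant⇒∣-average∣≤ : .{{_ : NonZero k}} {g : Fin k → ℕ} → NearlyConstant E g →
                             ∀ a → ∣ g a - sum g / k ∣ ≤ E
nearlyConstant⇒∣-average∣≤ {k} {E} {g} g≈ a = ∣m*n-o∣≤m*p⇒∣n-o/m∣≤p k (g a) (sum g) (begin
  ∣ k * g a - sum g ∣        ≡⟨ cong ∣_- sum g ∣ (∑-const k (g a)) ⟨
  ∣ ∑[ b < k ] g a - sum g ∣ ≤⟨ ∣∑-∑∣≤∑∣-∣ (λ _ → g a) g ⟩
  ∑[ b < k ] ∣ g a - g b ∣   ≤⟨ ∑-mono-≤ (spread≤ g≈ a) ⟩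
  ∑[ b < k ] E               ≡⟨ ∑-const k E ⟩
  k * E                      ∎)
  where open ≤-Reasoning

-- Sums over tuples

module TupleSum (n : ℕ) where

  ∑ᵗ : (m : ℕ) → (Vec (Fin n) m → ℕ) → ℕ
  ∑ᵗ zero    g = g []
  ∑ᵗ (suc m) g = ∑[ x < n ] ∑ᵗ m (λ v → g (x ∷ v))

  ∑ᵗ-cong : ∀ m {g h : Vec (Fin n) m → ℕ} → (∀ v → g v ≡ h v) → ∑ᵗ m g ≡ ∑ᵗ m h
  ∑ᵗ-cong zero    g≡h = g≡h []
  ∑ᵗ-cong (suc m) g≡h = sum-cong-≗ λ x → ∑ᵗ-cong m (λ v → g≡h (x ∷ v))

  ∑ᵗ-distrib-+ : ∀ m (g h : Vec (Fin n) m → ℕ) → ∑ᵗ m (λ v → g v + h v) ≡ ∑ᵗ m g + ∑ᵗ m h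
  ∑ᵗ-distrib-+ zero    g h = refl
  ∑ᵗ-distrib-+ (suc m) g h =
    trans (sum-cong-≗ λ x → ∑ᵗ-distrib-+ m (λ v → g (x ∷ v)) (λ v → h (x ∷ v)))
          (∑-distrib-+ (λ x → ∑ᵗ m (λ v → g (x ∷ v))) (λ x → ∑ᵗ m (λ v → h (x ∷ v))))

  *-distribˡ-∑ᵗ : ∀ m c (g : Vec (Fin n) m → ℕ) → c * ∑ᵗ m g ≡ ∑ᵗ m (λ v → c * g v)
  *-distribˡ-∑ᵗ zero    c g = refl
  *-distribˡ-∑ᵗ (suc m) c g =
    trans (*-distribˡ-sum c (λ x → ∑ᵗ m (λ v → g (x ∷ v)))) (sum-cong-≗ λ x → *-distribˡ-∑ᵗ m c (λ v → g (x ∷ v)))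

  ∑ᵗ-const : ∀ m c → ∑ᵗ m (λ _ → c) ≡ n ^ m * c
  ∑ᵗ-const zero    c = sym (+-identityʳ c)
  ∑ᵗ-const (suc m) c = begin
    ∑[ x < n ] ∑ᵗ m (λ _ → c) ≡⟨ sum-cong-≗ {n} (λ _ → ∑ᵗ-const m c) ⟩
    ∑[ x < n ] (n ^ m * c)    ≡⟨ ∑-const n (n ^ m * c) ⟩
    n * (n ^ m * c)           ≡⟨ *-assoc n (n ^ m) c ⟨
    n * n ^ m * c             ∎
    where open ≡-Reasoning

  ∑ᵗ-mono-≤ : ∀ m {g h : Vec (Fin n) m → ℕ} → (∀ v → g v ≤ h v) → ∑ᵗ m g ≤ ∑ᵗ m h
  ∑ᵗ-mono-≤ zero    g≤h = g≤h []
  ∑ᵗ-mono-≤ (suc m) g≤h = ∑-mono-≤ λ x → ∑ᵗ-mono-≤ m (λ v → g≤h (x ∷ v))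

  ∑ᵗ-∑-comm : ∀ m {k} (g : Fin k → Vec (Fin n) m → ℕ) →
              ∑ᵗ m (λ v → ∑[ j < k ] g j v) ≡ ∑[ j < k ] ∑ᵗ m (g j)
  ∑ᵗ-∑-comm zero    g = refl
  ∑ᵗ-∑-comm (suc m) g =
    trans (sum-cong-≗ λ x → ∑ᵗ-∑-comm m (λ j v → g j (x ∷ v))) (∑-comm λ x j → ∑ᵗ m (λ v → g j (x ∷ v)))

  length-filter-allTuples : ∀ m {P : Vec (Fin n) m → Set p} (P? : Decidable P) →
                            length (filter P? (allTuples n m)) ≡ ∑ᵗ m (λ v → ⟦ P? v ⟧)
  length-filter-allTuples zero    P? = trans (length-filter-∷ P? [] []) (+-identityʳ _)
  length-filter-allTuples (suc m) P? = begin
    length (filter P? (allTuples n (suc m)))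
      ≡⟨ length-filter-concatMap-tabulate P? (λ x → map (x ∷_) (allTuples n m)) id ⟩
    ∑[ x < n ] length (filter P? (map (x ∷_) (allTuples n m)))
      ≡⟨ sum-cong-≗ (λ x → length-filter-map P? (x ∷_) (allTuples n m)) ⟩
    ∑[ x < n ] length (filter (P? ∘ (x ∷_)) (allTuples n m))
      ≡⟨ sum-cong-≗ (λ x → length-filter-allTuples m (P? ∘ (x ∷_))) ⟩
    ∑ᵗ (suc m) (λ v → ⟦ P? v ⟧) ∎
    where open ≡-Reasoning

updateAt⁺ : ∀ {A : Set a} {Q : A → Set p} {g : A → A} → (∀ {x} → Q x → Q (g x)) →
            {xs : Vec A m} (i : Fin m) → All Q xs → All Q (updateAt xs i g)
updateAt⁺ g⁺ zero    (px ∷ pxs) = g⁺ px ∷ pxs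
updateAt⁺ g⁺ (suc i) (px ∷ pxs) = px ∷ updateAt⁺ g⁺ i pxs

sum-updateAt-+ : ∀ (c : Vec ℕ m) i k → Vec.sum (updateAt c i (k +_)) ≡ k + Vec.sum c
sum-updateAt-+ (c₀ ∷ c) zero    k = +-assoc k c₀ (Vec.sum c)
sum-updateAt-+ (c₀ ∷ c) (suc i) k = trans (cong (c₀ +_) (sum-updateAt-+ c i k)) (ℕ+.x∙yz≈y∙xz c₀ k (Vec.sum c))

sum-replicate : ∀ m x → Vec.sum (replicate m x) ≡ m * x
sum-replicate zero    x = refl
sum-replicate (suc m) x = cong (x +_) (sum-replicate m x)

unit-or-≥2 : {kz : Vec ℕ f} → All (1 ≤_) kz → Any (_≡ 1) kz ⊎ All (2 ≤_) kz
unit-or-≥2 []                   = inj₂ []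
unit-or-≥2 {kz = k ∷ _} (k≥1 ∷ kz≥1) with k ≟ℕ 1 | unit-or-≥2 kz≥1
... | yes k≡1 | _          = inj₁ (here k≡1)
... | no _    | inj₁ unit  = inj₁ (there unit)
... | no k≢1  | inj₂ kz≥2 = inj₂ (≤∧≢⇒< k≥1 (k≢1 ∘ sym) ∷ kz≥2)

length≤⌊sum/2⌋ : {kz : Vec ℕ f} → All (2 ≤_) kz → f ≤ ⌊ Vec.sum kz /2⌋
length≤⌊sum/2⌋ []                   = z≤n
length≤⌊sum/2⌋ {kz = _ ∷ kz} (k≥2 ∷ kz≥2) =
  ≤-trans (s≤s (length≤⌊sum/2⌋ kz≥2)) (⌊n/2⌋-mono (+-monoˡ-≤ (Vec.sum kz) k≥2))

nPk≡nP′k : ∀ {n k} → k ≤ n → n P k ≡ n P′ k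
nPk≡nP′k k≤n = trans (nPk≡n!/[n∸k]! k≤n) (sym (nP′k≡n!/[n∸k]! k≤n))

-- Sums over distinct tuples in a finite abelian group

module SubsetSums {n : ℕ} (G : FinAbGroup n) where

  open FinAbGroup G
  open TupleSum n

  +-abelianGroup : AbelianGroup 0ℓ 0ℓ
  +-abelianGroup = record { isAbelianGroup = isAbelianGroup }

  open AbelianGroup +-abelianGroup using (assoc; identityˡ; group; monoid; commutativeSemigroup)
  open import Algebra.Properties.Group group using (//-rightDividesˡ; //-rightDividesʳ)
  open import Algebra.Properties.Monoid.Mult monoid using (×-homo-1; ×-homo-+) renaming (_×_ to _·_)
  open CommutativeSemigroupProperties commutativeSemigroup using (x∙yz≈y∙xz; x∙yz≈yx∙z)

  private instance
    n≢0 : NonZero n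
    n≢0 = nonZeroIndex 0ᴳ

  lin : Vec ℕ m → Vec (Fin n) m → Fin n
  lin []      []       = 0ᴳ
  lin (k ∷ c) (y ∷ ys) = (k · y) +ᴳ lin c ys

  lin-updateAt : ∀ (c : Vec ℕ m) j k ys → lin (updateAt c j (k +_)) ys ≡ (k · lookup ys j) +ᴳ lin c ys
  lin-updateAt (c₀ ∷ c) zero    k (y ∷ ys) = trans (cong (_+ᴳ lin c ys) (×-homo-+ y k c₀)) (assoc _ _ _)
  lin-updateAt (c₀ ∷ c) (suc j) k (y ∷ ys) =
    trans (cong ((c₀ · y) +ᴳ_) (lin-updateAt c j k ys)) (x∙yz≈y∙xz _ _ _)

  lin-replicate-1 : (v : Vec (Fin n) m) → lin (replicate m 1) v ≡ tupleSum G v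
  lin-replicate-1 []      = refl
  lin-replicate-1 (y ∷ v) = cong₂ _+ᴳ_ (×-homo-1 y) (lin-replicate-1 v)

  ∑-⟦y+s≟a⟧ : ∀ s a → ∑[ y < n ] ⟦ y +ᴳ s ≟ a ⟧ ≡ 1
  ∑-⟦y+s≟a⟧ s a = trans (sum-cong-≗ λ y → ⟦⟧-⇔ (solve y) (y +ᴳ s ≟ a) (y ≟ a +ᴳ (-ᴳ s))) (∑-⟦≟⟧ˡ (a +ᴳ (-ᴳ s)))
    where
    solve : ∀ y → (y +ᴳ s ≡ a) ⇔ (y ≡ a +ᴳ (-ᴳ s))
    solve y = mk⇔ (λ y+s≡a → trans (sym (//-rightDividesʳ s y)) (cong (_+ᴳ (-ᴳ s)) y+s≡a))
                  (λ y≡a-s → trans (cong (_+ᴳ s) y≡a-s) (//-rightDividesˡ s a))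

  distinct? : (v : Vec (Fin n) m) → Dec (Unique (toList v))
  distinct? v = UniqueDec.unique? _≟_ (toList v)

  fresh? : (y : Fin n) (v : Vec (Fin n) m) → Dec (ListAll.All (y ≢_) (toList v))
  fresh? y v = ListAll.all? (λ z → ¬? (y ≟ z)) (toList v)

  ∑-fresh*+∑-lookup : (v : Vec (Fin n) m) → Unique (toList v) → (g : Fin n → ℕ) →
                      ∑[ y < n ] (⟦ fresh? y v ⟧ * g y) + ∑[ j < m ] g (lookup v j) ≡ sum g
  ∑-fresh*+∑-lookup [] [] g = trans (+-identityʳ _) (sum-cong-≗ λ y → *-identityˡ (g y))
  ∑-fresh*+∑-lookup {suc m} (z ∷ v) (z∉v ∷ v-distinct) g = begin
    ∑[ y < n ] (⟦ fresh? y (z ∷ v) ⟧ * g y) + (g z + ∑[ j < m ] g (lookup v j))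
      ≡⟨ cong₂ (λ s t → s + (t + ∑[ j < m ] g (lookup v j)))
               (sum-cong-≗ λ y → trans (cong (_* g y) (⟦×-dec⟧ (¬? (y ≟ z)) (fresh? y v)))
                                       (*-assoc ⟦ ¬? (y ≟ z) ⟧ ⟦ fresh? y v ⟧ (g y)))
               (sym (trans (cong (_* g z) (⟦⟧-true z∉v (fresh? z v))) (*-identityˡ (g z)))) ⟩
    ∑[ y < n ] (⟦ ¬? (y ≟ z) ⟧ * g′ y) + (g′ z + ∑[ j < m ] g (lookup v j))
      ≡⟨ +-assoc (∑[ y < n ] (⟦ ¬? (y ≟ z) ⟧ * g′ y)) (g′ z) _ ⟨
    ∑[ y < n ] (⟦ ¬? (y ≟ z) ⟧ * g′ y) + g′ z + ∑[ j < m ] g (lookup v j)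
      ≡⟨ cong (_+ ∑[ j < m ] g (lookup v j)) (∑-⟦≢⟧*+point z g′) ⟩
    sum g′ + ∑[ j < m ] g (lookup v j)
      ≡⟨ ∑-fresh*+∑-lookup v v-distinct g ⟩
    sum g ∎
    where
    open ≡-Reasoning
    g′ : Fin n → ℕ
    g′ y = ⟦ fresh? y v ⟧ * g y

  ∑-fresh : (v : Vec (Fin n) m) → Unique (toList v) → ∑[ y < n ] ⟦ fresh? y v ⟧ ≡ n ∸ m
  ∑-fresh {m} v v-distinct = trans (sym (m+n∸n≡m _ m)) (cong (_∸ m) ∑-fresh+m≡n)
    where
    open ≡-Reasoning
    ∑-fresh+m≡n : ∑[ y < n ] ⟦ fresh? y v ⟧ + m ≡ n
    ∑-fresh+m≡n = begin
      ∑[ y < n ] ⟦ fresh? y v ⟧ + m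
        ≡⟨ cong₂ _+_ (sum-cong-≗ λ y → sym (*-identityʳ ⟦ fresh? y v ⟧))
                     (sym (trans (∑-const m 1) (*-identityʳ m))) ⟩
      ∑[ y < n ] (⟦ fresh? y v ⟧ * 1) + ∑[ j < m ] 1
        ≡⟨ ∑-fresh*+∑-lookup v v-distinct (λ _ → 1) ⟩
      ∑[ y < n ] 1
        ≡⟨ trans (∑-const n 1) (*-identityʳ n) ⟩
      n ∎

  ∑ᵗ-distinct : ∀ m → ∑ᵗ m (λ v → ⟦ distinct? v ⟧) ≡ n P′ m
  ∑ᵗ-distinct zero    = refl
  ∑ᵗ-distinct (suc m) = begin
    ∑[ y < n ] ∑ᵗ m (λ v → ⟦ distinct? (y ∷ v) ⟧)
      ≡⟨ sum-cong-≗ (λ y → ∑ᵗ-cong m λ v → ⟦×-dec⟧ (fresh? y v) (distinct? v)) ⟩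
    ∑[ y < n ] ∑ᵗ m (λ v → ⟦ fresh? y v ⟧ * ⟦ distinct? v ⟧)
      ≡⟨ ∑ᵗ-∑-comm m (λ y v → ⟦ fresh? y v ⟧ * ⟦ distinct? v ⟧) ⟨
    ∑ᵗ m (λ v → ∑[ y < n ] (⟦ fresh? y v ⟧ * ⟦ distinct? v ⟧))
      ≡⟨ ∑ᵗ-cong m count ⟩
    ∑ᵗ m (λ v → (n ∸ m) * ⟦ distinct? v ⟧)
      ≡⟨ *-distribˡ-∑ᵗ m (n ∸ m) _ ⟨
    (n ∸ m) * ∑ᵗ m (λ v → ⟦ distinct? v ⟧)
      ≡⟨ cong ((n ∸ m) *_) (∑ᵗ-distinct m) ⟩
    (n ∸ m) * (n P′ m) ∎
    where
    open ≡-Reasoning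
    count : ∀ v → ∑[ y < n ] (⟦ fresh? y v ⟧ * ⟦ distinct? v ⟧) ≡ (n ∸ m) * ⟦ distinct? v ⟧
    count v = begin
      ∑[ y < n ] (⟦ fresh? y v ⟧ * ⟦ distinct? v ⟧) ≡⟨ *-distribʳ-sum ⟦ distinct? v ⟧ (λ y → ⟦ fresh? y v ⟧) ⟨
      ∑[ y < n ] ⟦ fresh? y v ⟧ * ⟦ distinct? v ⟧   ≡⟨ *-comm _ ⟦ distinct? v ⟧ ⟩
      ⟦ distinct? v ⟧ * ∑[ y < n ] ⟦ fresh? y v ⟧   ≡⟨ ⟦⟧*-cong (distinct? v) (∑-fresh v) ⟩
      ⟦ distinct? v ⟧ * (n ∸ m)                   ≡⟨ *-comm ⟦ distinct? v ⟧ (n ∸ m) ⟩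
      (n ∸ m) * ⟦ distinct? v ⟧                   ∎

  distinctSum : Vec ℕ m → (Fin n → ℕ) → ℕ
  distinctSum {m} c φ = ∑ᵗ m (λ v → ⟦ distinct? v ⟧ * φ (lin c v))

  distinctSum-cong : ∀ (c : Vec ℕ m) {φ ψ : Fin n → ℕ} → (∀ t → φ t ≡ ψ t) → distinctSum c φ ≡ distinctSum c ψ
  distinctSum-cong {m} c φ≡ψ = ∑ᵗ-cong m λ v → cong (⟦ distinct? v ⟧ *_) (φ≡ψ (lin c v))

  shiftSum : ℕ → (Fin n → ℕ) → Fin n → ℕ
  shiftSum k φ t = ∑[ y < n ] φ ((k · y) +ᴳ t)

  -- The first variable y either avoids the remaining ones or equals exactly one of them, vⱼ,
  -- and then k · y is absorbed into the j-th coefficient.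
  distinctSum-∷ : ∀ k (c : Vec ℕ m) (φ : Fin n → ℕ) →
    distinctSum (k ∷ c) φ + ∑[ j < m ] distinctSum (updateAt c j (k +_)) φ ≡ distinctSum c (shiftSum k φ)
  distinctSum-∷ {m} k c φ = begin
    distinctSum (k ∷ c) φ + ∑[ j < m ] distinctSum (updateAt c j (k +_)) φ
      ≡⟨ cong₂ _+_ y-fresh y-repeated ⟩
    ∑ᵗ m (λ v → ⟦ distinct? v ⟧ * ∑[ y < n ] (⟦ fresh? y v ⟧ * ψ v y))
      + ∑ᵗ m (λ v → ⟦ distinct? v ⟧ * ∑[ j < m ] ψ v (lookup v j))
      ≡⟨ ∑ᵗ-distrib-+ m _ _ ⟨
    ∑ᵗ m (λ v → ⟦ distinct? v ⟧ * ∑[ y < n ] (⟦ fresh? y v ⟧ * ψ v y)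
              + ⟦ distinct? v ⟧ * ∑[ j < m ] ψ v (lookup v j))
      ≡⟨ ∑ᵗ-cong m (λ v → trans (sym (*-distribˡ-+ ⟦ distinct? v ⟧ _ _))
                               (⟦⟧*-cong (distinct? v) λ v-distinct → ∑-fresh*+∑-lookup v v-distinct (ψ v))) ⟩
    distinctSum c (shiftSum k φ) ∎
    where
    open ≡-Reasoning
    ψ : Vec (Fin n) m → Fin n → ℕ
    ψ v y = φ ((k · y) +ᴳ lin c v)
    y-fresh : distinctSum (k ∷ c) φ ≡ ∑ᵗ m (λ v → ⟦ distinct? v ⟧ * ∑[ y < n ] (⟦ fresh? y v ⟧ * ψ v y))
    y-fresh = begin
      ∑[ y < n ] ∑ᵗ m (λ v → ⟦ distinct? (y ∷ v) ⟧ * ψ v y)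
        ≡⟨ sum-cong-≗ (λ y → ∑ᵗ-cong m λ v → begin
             ⟦ distinct? (y ∷ v) ⟧ * ψ v y             ≡⟨ cong (_* ψ v y) (⟦×-dec⟧ (fresh? y v) (distinct? v)) ⟩
             ⟦ fresh? y v ⟧ * ⟦ distinct? v ⟧ * ψ v y   ≡⟨ cong (_* ψ v y) (*-comm ⟦ fresh? y v ⟧ _) ⟩
             ⟦ distinct? v ⟧ * ⟦ fresh? y v ⟧ * ψ v y   ≡⟨ *-assoc ⟦ distinct? v ⟧ _ _ ⟩
             ⟦ distinct? v ⟧ * (⟦ fresh? y v ⟧ * ψ v y) ∎) ⟩
      ∑[ y < n ] ∑ᵗ m (λ v → ⟦ distinct? v ⟧ * (⟦ fresh? y v ⟧ * ψ v y))
        ≡⟨ ∑ᵗ-∑-comm m (λ y v → ⟦ distinct? v ⟧ * (⟦ fresh? y v ⟧ * ψ v y)) ⟨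
      ∑ᵗ m (λ v → ∑[ y < n ] (⟦ distinct? v ⟧ * (⟦ fresh? y v ⟧ * ψ v y)))
        ≡⟨ ∑ᵗ-cong m (λ v → *-distribˡ-sum ⟦ distinct? v ⟧ (λ y → ⟦ fresh? y v ⟧ * ψ v y)) ⟨
      ∑ᵗ m (λ v → ⟦ distinct? v ⟧ * ∑[ y < n ] (⟦ fresh? y v ⟧ * ψ v y)) ∎
    y-repeated : ∑[ j < m ] distinctSum (updateAt c j (k +_)) φ
               ≡ ∑ᵗ m (λ v → ⟦ distinct? v ⟧ * ∑[ j < m ] ψ v (lookup v j))
    y-repeated = begin
      ∑[ j < m ] ∑ᵗ m (λ v → ⟦ distinct? v ⟧ * φ (lin (updateAt c j (k +_)) v))
        ≡⟨ ∑ᵗ-∑-comm m (λ j v → ⟦ distinct? v ⟧ * φ (lin (updateAt c j (k +_)) v)) ⟨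
      ∑ᵗ m (λ v → ∑[ j < m ] (⟦ distinct? v ⟧ * φ (lin (updateAt c j (k +_)) v)))
        ≡⟨ ∑ᵗ-cong m (λ v → sum-cong-≗ λ j → cong (λ t → ⟦ distinct? v ⟧ * φ t) (lin-updateAt c j k v)) ⟩
      ∑ᵗ m (λ v → ∑[ j < m ] (⟦ distinct? v ⟧ * ψ v (lookup v j)))
        ≡⟨ ∑ᵗ-cong m (λ v → *-distribˡ-sum ⟦ distinct? v ⟧ (λ j → ψ v (lookup v j))) ⟨
      ∑ᵗ m (λ v → ⟦ distinct? v ⟧ * ∑[ j < m ] ψ v (lookup v j)) ∎

  solutions : Vec ℕ f → Fin n → Fin n → ℕ
  solutions {f} kz a t = ∑ᵗ f (λ z → ⟦ lin kz z +ᴳ t ≟ a ⟧)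

  shiftSum-solutions : ∀ k (kz : Vec ℕ f) a t → shiftSum k (solutions kz a) t ≡ solutions (k ∷ kz) a t
  shiftSum-solutions {f} k kz a t = sum-cong-≗ λ y → ∑ᵗ-cong f λ z →
    cong (λ w → ⟦ w ≟ a ⟧) (x∙yz≈yx∙z (lin kz z) (k · y) t)

  solutions-≤ : ∀ (kz : Vec ℕ f) a t → solutions kz a t ≤ n ^ f
  solutions-≤ {f} kz a t = begin
    solutions kz a t ≤⟨ ∑ᵗ-mono-≤ f (λ z → ⟦⟧≤1 (lin kz z +ᴳ t ≟ a)) ⟩
    ∑ᵗ f (λ _ → 1)   ≡⟨ ∑ᵗ-const f 1 ⟩
    n ^ f * 1        ≡⟨ *-identityʳ (n ^ f) ⟩
    n ^ f            ∎
    where open ≤-Reasoning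

  solutions-unit : {kz : Vec ℕ (suc f)} → Any (_≡ 1) kz → ∀ a t → solutions kz a t ≡ n ^ f
  solutions-unit {f} {_ ∷ kz} (here refl) a t = begin
    ∑[ y < n ] ∑ᵗ f (λ z → ⟦ ((1 · y) +ᴳ lin kz z) +ᴳ t ≟ a ⟧)
      ≡⟨ ∑ᵗ-∑-comm f (λ y z → ⟦ ((1 · y) +ᴳ lin kz z) +ᴳ t ≟ a ⟧) ⟨
    ∑ᵗ f (λ z → ∑[ y < n ] ⟦ ((1 · y) +ᴳ lin kz z) +ᴳ t ≟ a ⟧)
      ≡⟨ ∑ᵗ-cong f (λ z → trans (sum-cong-≗ λ y → cong (λ w → ⟦ w ≟ a ⟧) (regroup y z))
                                (∑-⟦y+s≟a⟧ (lin kz z +ᴳ t) a)) ⟩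
    ∑ᵗ f (λ _ → 1)
      ≡⟨ ∑ᵗ-const f 1 ⟩
    n ^ f * 1
      ≡⟨ *-identityʳ (n ^ f) ⟩
    n ^ f ∎
    where
    open ≡-Reasoning
    regroup : ∀ y z → ((1 · y) +ᴳ lin kz z) +ᴳ t ≡ y +ᴳ (lin kz z +ᴳ t)
    regroup y z = trans (cong (λ w → (w +ᴳ lin kz z) +ᴳ t) (×-homo-1 y)) (assoc y (lin kz z) t)
  solutions-unit {suc f} {k ∷ kz} (there unit) a t = begin
    solutions (k ∷ kz) a t                  ≡⟨ shiftSum-solutions k kz a t ⟨
    ∑[ y < n ] solutions kz a ((k · y) +ᴳ t) ≡⟨ sum-cong-≗ (λ y → solutions-unit unit a ((k · y) +ᴳ t)) ⟩
    ∑[ y < n ] (n ^ f)                      ≡⟨ ∑-const n (n ^ f) ⟩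
    n * n ^ f                               ∎
    where open ≡-Reasoning
  solutions-unit {zero} {_ ∷ []} (there ())

  solutions-nearlyConstant : (kz : Vec ℕ f) → All (1 ≤_) kz →
                             NearlyConstant (n ^ ⌊ Vec.sum kz /2⌋) (λ a → solutions kz a 0ᴳ)
  solutions-nearlyConstant kz kz≥1 with unit-or-≥2 kz≥1
  solutions-nearlyConstant []      _ | inj₁ ()
  solutions-nearlyConstant (_ ∷ _) _ | inj₁ unit  = constant⇒nearlyConstant _ (λ a → solutions-unit unit a 0ᴳ)
  solutions-nearlyConstant kz      _ | inj₂ kz≥2 = bounded⇒nearlyConstant λ a →
    ≤-trans (solutions-≤ kz a 0ᴳ) (^-monoʳ-≤ n (length≤⌊sum/2⌋ kz≥2))

  -- The error constant K satisfies K (m + 1) = K m + m · K m, so K m = m !.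
  distinctSum-solutions-nearlyConstant :
    (c : Vec ℕ m) (kz : Vec ℕ f) → All (1 ≤_) c → All (1 ≤_) kz → Vec.sum c + Vec.sum kz ≡ s →
    NearlyConstant (m ! * n ^ ⌊ s /2⌋) (λ a → distinctSum c (solutions kz a))
  distinctSum-solutions-nearlyConstant [] kz [] kz≥1 refl =
    nearlyConstant-mono (≤-reflexive (sym (*-identityˡ (n ^ ⌊ Vec.sum kz /2⌋))))
      (nearlyConstant-cong (λ a → sym (*-identityˡ (solutions kz a 0ᴳ))) (solutions-nearlyConstant kz kz≥1))
  distinctSum-solutions-nearlyConstant {suc m} {s = s} (k ∷ c) kz (k≥1 ∷ c≥1) kz≥1 c+kz≡s =
    subst (λ E → NearlyConstant E (λ a → distinctSum (k ∷ c) (solutions kz a)))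
          (sym (*-assoc (suc m) (m !) X))
          (nearlyConstant-cancelʳ split freed merged)
    where
    X = n ^ ⌊ s /2⌋
    split : ∀ a → distinctSum (k ∷ c) (solutions kz a)
                  + ∑[ j < m ] distinctSum (updateAt c j (k +_)) (solutions kz a)
                ≡ distinctSum c (solutions (k ∷ kz) a)
    split a = trans (distinctSum-∷ k c (solutions kz a)) (distinctSum-cong c (shiftSum-solutions k kz a))
    freed : NearlyConstant (m ! * X) (λ a → distinctSum c (solutions (k ∷ kz) a))
    freed = distinctSum-solutions-nearlyConstant c (k ∷ kz) c≥1 (k≥1 ∷ kz≥1)
              (trans (ℕ+.x∙yz≈yx∙z (Vec.sum c) k (Vec.sum kz)) c+kz≡s)
    merged : NearlyConstant (m * (m ! * X))
                            (λ a → ∑[ j < m ] distinctSum (updateAt c j (k +_)) (solutions kz a))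
    merged = nearlyConstant-∑ λ j →
      distinctSum-solutions-nearlyConstant (updateAt c j (k +_)) kz
        (updateAt⁺ (λ x≥1 → ≤-trans x≥1 (m≤n+m _ k)) j c≥1) kz≥1
        (trans (cong (_+ Vec.sum kz) (sum-updateAt-+ c j k)) c+kz≡s)

  T≡∑ᵗ : ∀ h a → T G h a ≡ ∑ᵗ h (λ v → ⟦ distinct? v ⟧ * ⟦ tupleSum G v ≟ a ⟧)
  T≡∑ᵗ h a = trans (length-filter-allTuples h _)
                   (∑ᵗ-cong h λ v → ⟦×-dec⟧ (distinct? v) (tupleSum G v ≟ a))

  T≡distinctSum : ∀ h a → T G h a ≡ distinctSum (replicate h 1) (solutions [] a)
  T≡distinctSum h a = trans (T≡∑ᵗ h a) (∑ᵗ-cong h λ v → cong (λ w → ⟦ distinct? v ⟧ * ⟦ w ≟ a ⟧)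
    (trans (sym (lin-replicate-1 v)) (sym (identityˡ _))))

  T-nearlyConstant : ∀ h → NearlyConstant (h ! * n ^ ⌊ h /2⌋) (T G h)
  T-nearlyConstant h = nearlyConstant-cong (λ a → sym (T≡distinctSum h a))
    (distinctSum-solutions-nearlyConstant (replicate h 1) [] (ones h) []
      (trans (+-identityʳ _) (trans (sum-replicate h 1) (*-identityʳ h))))
    where
    ones : ∀ h → All (1 ≤_) (replicate h 1)
    ones zero    = []
    ones (suc h) = ≤-refl ∷ ones h

  ∑-T : ∀ h → ∑[ a < n ] T G h a ≡ n P′ h
  ∑-T h = begin
    ∑[ a < n ] T G h a
      ≡⟨ sum-cong-≗ (T≡∑ᵗ h) ⟩
    ∑[ a < n ] ∑ᵗ h (λ v → ⟦ distinct? v ⟧ * ⟦ tupleSum G v ≟ a ⟧)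
      ≡⟨ ∑ᵗ-∑-comm h (λ a v → ⟦ distinct? v ⟧ * ⟦ tupleSum G v ≟ a ⟧) ⟨
    ∑ᵗ h (λ v → ∑[ a < n ] (⟦ distinct? v ⟧ * ⟦ tupleSum G v ≟ a ⟧))
      ≡⟨ ∑ᵗ-cong h (λ v → trans (sym (*-distribˡ-sum ⟦ distinct? v ⟧ (λ a → ⟦ tupleSum G v ≟ a ⟧)))
                               (trans (cong (⟦ distinct? v ⟧ *_) (∑-⟦≟⟧ʳ (tupleSum G v))) (*-identityʳ _))) ⟩
    ∑ᵗ h (λ v → ⟦ distinct? v ⟧)
      ≡⟨ ∑ᵗ-distinct h ⟩
    n P′ h ∎
    where open ≡-Reasoning

  ∣T-nPh/n∣≤ : ∀ h → h ≤ n → ∀ a → ∣ T G h a - (n P h) / n ∣ ≤ h ! * n ^ ⌊ h /2⌋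
  ∣T-nPh/n∣≤ h h≤n a =
    subst (λ S → ∣ T G h a - S / n ∣ ≤ _) (trans (∑-T h) (sym (nPk≡nP′k h≤n)))
      (nearlyConstant⇒∣-average∣≤ (T-nearlyConstant h) a)

mainTerm≡nPh/n : ∀ n h .{{_ : NonZero n}} → mainTerm n h ≡ (n P h) / n
mainTerm≡nPh/n (suc _) _ = refl

m≤n*o^⌊p/2⌋⇒m²≤n*n*o^p : ∀ m n o p .{{_ : NonZero o}} → m ≤ n * o ^ ⌊ p /2⌋ → m ^ 2 ≤ n * n * o ^ p
m≤n*o^⌊p/2⌋⇒m²≤n*n*o^p m n o p m≤nX = begin
  m * (m * 1)         ≤⟨ *-mono-≤ m≤nX (*-monoˡ-≤ 1 m≤nX) ⟩
  n * X * (n * X * 1) ≡⟨ cong (n * X *_) (*-identityʳ (n * X)) ⟩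
  n * X * (n * X)     ≡⟨ ℕ*.interchange n X n X ⟩
  n * n * (X * X)     ≤⟨ *-monoʳ-≤ (n * n) X*X≤o^p ⟩
  n * n * o ^ p       ∎
  where
  open ≤-Reasoning
  X = o ^ ⌊ p /2⌋
  X*X≤o^p : X * X ≤ o ^ p
  X*X≤o^p = begin
    X * X                     ≡⟨ ^-distribˡ-+-* o ⌊ p /2⌋ ⌊ p /2⌋ ⟨
    o ^ (⌊ p /2⌋ + ⌊ p /2⌋)   ≤⟨ ^-monoʳ-≤ o (+-monoʳ-≤ ⌊ p /2⌋ (⌊n/2⌋≤⌈n/2⌉ p)) ⟩
    o ^ (⌊ p /2⌋ + ⌈ p /2⌉)   ≡⟨ cong (o ^_) (⌊n/2⌋+⌈n/2⌉≡n p) ⟩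
    o ^ p                     ∎

-- The bound holds for every h.
theorem5 : (h : ℕ) → 3 ≤ h →
    ∃[ C ] (0 < C × ((n : ℕ) → 2 * h ≤ n → (G : FinAbGroup n) → (a : Fin n) →
      ∣ T G h a - mainTerm n h ∣ ^ 2 ≤ C * n ^ h))
theorem5 h _ = h ! * h ! , *-mono-≤ (1≤n! h) (1≤n! h) , bound
  where
  bound : (n : ℕ) → 2 * h ≤ n → (G : FinAbGroup n) → (a : Fin n) →
          ∣ T G h a - mainTerm n h ∣ ^ 2 ≤ h ! * h ! * n ^ h
  bound n 2h≤n G a = m≤n*o^⌊p/2⌋⇒m²≤n*n*o^p _ (h !) n h
    (subst (λ M → ∣ T G h a - M ∣ ≤ h ! * n ^ ⌊ h /2⌋) (sym (mainTerm≡nPh/n n h))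
      (SubsetSums.∣T-nPh/n∣≤ G h (≤-trans (m≤m+n h (h + 0)) 2h≤n) a))
    where
    instance
      n≢0 : NonZero n
      n≢0 = nonZeroIndex (FinAbGroup.0ᴳ G)
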